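{- Let $n\ge 2$ and let a Skolem sequence of order $n$ be given, where $(a_k,b_k)$ with $a_k<b_k$, $b_k-a_k=k$, are the two positions of $k$ for $1\le k\le n$. Let $1\le i,j\le n$ with $i\ne j$. Suppose a windmill (a graph consisting of cycles sharing one common vertex) is labelled so that two of its triangle vanes have vertex labels $(0,i,b_i+n)$ and $(0,j,b_j+n)$. If these two triangles are removed and replaced by a $6$-cycle whose vertices, in cyclic order, are labelled $(0,b_i+n,i,i+j,j,b_j+n)$ (sharing the vertex labelled $0$), then the edge labels are preserved; that is, the multiset of edge labels $|f(u)-f(v)|$ over the edges of the two triangles equals the multiset of edge labels over the edges of the $6$-cycle.
   Context: A Skolem sequence of order $n$ is a sequence $(s_1,\ldots,s_{2n})$ in which each $k\in\{1,\ldots,n\}$ occurs in exactly two positions $a_k<b_k$ with $b_k-a_k=k$. Edges receive the label $|f(u)-f(v)|$, where $f$ is the vertex labelling. -}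

module Defs where

open import Data.Nat using (ℕ; zero; suc; _+_; _*_; _≤_; _<_; ∣_-_∣)
open import Data.List using (List; []; _∷_; _++_)
open import Data.Product using (_×_)
open import Data.Sum using (_⊎_)
open import Relation.Binary.PropositionalEquality using (_≡_)
open import Function.Bundles using (_⇔_)

-- A Skolem sequence of order n: a sequence s_1,…,s_{2n} (positions are
-- natural numbers 1..2n; values of s outside that range are irrelevant)
-- together with, for each 1 ≤ k ≤ n, the two positions a_k < b_k of k,
-- with b_k - a_k = k, such that k occurs exactly at positions a_k and b_k.
record Skolem (n : ℕ) : Set where
  field
    s : ℕ → ℕ
    a : ℕ → ℕ
    b : ℕ → ℕ
    a-pos   : ∀ k → 1 ≤ k → k ≤ n → 1 ≤ a k
    a<b     : ∀ k → 1 ≤ k → k ≤ n → a k < b k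
    b-pos   : ∀ k → 1 ≤ k → k ≤ n → b k ≤ 2 * n
    b-a≡k   : ∀ k → 1 ≤ k → k ≤ n → b k ≡ a k + k
    occurs  : ∀ k p → 1 ≤ k → k ≤ n → 1 ≤ p → p ≤ 2 * n →
              (s p ≡ k ⇔ (p ≡ a k ⊎ p ≡ b k))
    values  : ∀ p → 1 ≤ p → p ≤ 2 * n → 1 ≤ s p × s p ≤ n

pathLabels : List ℕ → List ℕ
pathLabels []            = []
pathLabels (x ∷ [])      = []
pathLabels (x ∷ y ∷ xs)  = ∣ x - y ∣ ∷ pathLabels (y ∷ xs)

cycleLabels : List ℕ → List ℕ
cycleLabels []       = []
cycleLabels (x ∷ xs) = pathLabels ((x ∷ xs) ++ (x ∷ []))

-- The 6-cycle keeps the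
-- outer edges x, |x - i| and |j - y|, y of the two triangles, while the path
-- i, i + j, j contributes the edges |i - (i + j)| = j and |(i + j) - j| = i,
-- which take the place of the triangles' spokes 0 — i and 0 — j.  This works
-- for arbitrary labels i, j, x, y.
module Submission where

open import Defs
open import Data.Nat using (ℕ; _+_; _≤_; ∣_-_∣)
open import Data.Nat.Properties using (∣-∣-comm; ∣m-m+n∣≡n; +-comm; ∣-∣-identityʳ)
open import Data.List using (List; []; _∷_; _++_)
open import Relation.Binary.PropositionalEquality using (_≡_; refl; cong; cong₂; module ≡-Reasoning)
open import Relation.Nullary using (¬_)
open import Data.List.Relation.Binary.Permutation.Propositional
  using (_↭_; ↭-refl; ↭-trans; prep; swap; module PermutationReasoning)

∣m+n-n∣≡m : ∀ m n → ∣ m + n - n ∣ ≡ m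
∣m+n-n∣≡m m n = begin
  ∣ m + n - n ∣ ≡⟨ ∣-∣-comm (m + n) n ⟩
  ∣ n - m + n ∣ ≡⟨ cong (λ k → ∣ n - k ∣) (+-comm m n) ⟩
  ∣ n - n + m ∣ ≡⟨ ∣m-m+n∣≡n n m ⟩
  m             ∎
  where open ≡-Reasoning

triangleLabels : ∀ i x → cycleLabels (0 ∷ i ∷ x ∷ []) ≡ i ∷ ∣ i - x ∣ ∷ x ∷ []
triangleLabels i x rewrite ∣-∣-identityʳ x = refl

hexagonLabels : ∀ i j x y →
  cycleLabels (0 ∷ x ∷ i ∷ (i + j) ∷ j ∷ y ∷ []) ≡ x ∷ ∣ i - x ∣ ∷ j ∷ i ∷ ∣ j - y ∣ ∷ y ∷ []
hexagonLabels i j x y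
  rewrite ∣m-m+n∣≡n i j | ∣m+n-n∣≡m i j | ∣-∣-comm x i | ∣-∣-identityʳ y = refl

↭-rotate-triangle : ∀ {A : Set} (i d x j : A) (ys : List A) →
  (i ∷ d ∷ x ∷ j ∷ ys) ↭ (x ∷ d ∷ j ∷ i ∷ ys)
↭-rotate-triangle i d x j ys =
  ↭-trans (swap i d ↭-refl)
  (↭-trans (prep d (swap i x ↭-refl))
  (↭-trans (swap d x ↭-refl)
           (prep x (prep d (swap i j ↭-refl)))))

triangles↭hexagon : ∀ i j x y →
  (cycleLabels (0 ∷ i ∷ x ∷ []) ++ cycleLabels (0 ∷ j ∷ y ∷ []))
  ↭ cycleLabels (0 ∷ x ∷ i ∷ (i + j) ∷ j ∷ y ∷ [])
triangles↭hexagon i j x y = begin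
  cycleLabels (0 ∷ i ∷ x ∷ []) ++ cycleLabels (0 ∷ j ∷ y ∷ [])
    ≡⟨ cong₂ _++_ (triangleLabels i x) (triangleLabels j y) ⟩
  i ∷ ∣ i - x ∣ ∷ x ∷ j ∷ ∣ j - y ∣ ∷ y ∷ []
    ↭⟨ ↭-rotate-triangle i ∣ i - x ∣ x j (∣ j - y ∣ ∷ y ∷ []) ⟩
  x ∷ ∣ i - x ∣ ∷ j ∷ i ∷ ∣ j - y ∣ ∷ y ∷ []
    ≡⟨ hexagonLabels i j x y ⟨
  cycleLabels (0 ∷ x ∷ i ∷ (i + j) ∷ j ∷ y ∷ []) ∎
  where open PermutationReasoning

lemma6p1 : (n : ℕ) → 2 ≤ n → (S : Skolem n) → (i j : ℕ) →
           1 ≤ i → i ≤ n → 1 ≤ j → j ≤ n → ¬ (i ≡ j) →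
           (cycleLabels (0 ∷ i ∷ (Skolem.b S i + n) ∷ [])
             ++ cycleLabels (0 ∷ j ∷ (Skolem.b S j + n) ∷ []))
           ↭ cycleLabels (0 ∷ (Skolem.b S i + n) ∷ i ∷ (i + j) ∷ j ∷ (Skolem.b S j + n) ∷ [])
lemma6p1 n _ S i j _ _ _ _ _ = triangles↭hexagon i j (Skolem.b S i + n) (Skolem.b S j + n)
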